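{- For every positive integer $d$ there exists a transitive digraph $D$ with $\dim(D) > d$.
   Context: All digraphs are finite and have simple underlying graphs (no loops, no multiple arcs, and at most one arc between any two vertices). For an integer $d\ge 0$ write $[d]=\{1,\dots,d\}$ (with $\mathbb{R}^0=\{0\}$). For $x=(x_1,\dots,x_d),y\in\mathbb{R}^d$ let $\mathcal{G}_{x>y}=\{i\in[d]: x_i>y_i\}$. The weak majority relation on $\mathbb{R}^d$ is defined by $x\succ y$ (equivalently $y\prec x$) iff $|\mathcal{G}_{x>y}|-|\mathcal{G}_{y>x}|>0$. A map $f:V(D)\to\mathbb{R}^d$ is an $\mathbb{R}^d$-realizer of a digraph $D$ if for all vertices $x,y$: $(x,y)\in A(D)$ iff $f(x)\succ f(y)$. The weak majority dimension $\dim(D)$ is the minimum nonnegative integer $d$ such that $D$ has an $\mathbb{R}^d$-realizer (such $d$ always exists). A digraph $D$ is transitive if $(x,z)\in A(D)$ whenever $(x,y)\in A(D)$ and $(y,z)\in A(D)$. -}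

module Defs where

open import Level using (0ℓ)
open import Data.Nat using (ℕ; zero; suc; _<_; _≤_)
open import Data.Fin using (Fin)
import Data.Fin as F
open import Data.Product using (_×_; Σ)
open import Relation.Nullary using (¬_; Dec; yes; no)
open import Relation.Binary.Bundles using (StrictTotalOrder)

record Digraph (n : ℕ) : Set₁ where
  field
    Arc      : Fin n → Fin n → Set
    loopless : ∀ x → ¬ Arc x x
    oneArc   : ∀ x y → Arc x y → ¬ Arc y x
open Digraph public

Transitive : ∀ {n} → Digraph n → Set
Transitive D = ∀ x y z → Arc D x y → Arc D y z → Arc D x z

count : ∀ {d} {P : Fin d → Set} → (∀ i → Dec (P i)) → ℕ
count {zero}  p? = 0
count {suc d} p? with p? F.zero
... | yes _ = suc (count (λ i → p? (F.suc i)))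
... | no  _ = count (λ i → p? (F.suc i))

-- Weak majority relation on O^d for a linearly ordered set O
-- (the paper uses O = ℝ with its usual order).
module Majority (O : StrictTotalOrder 0ℓ 0ℓ 0ℓ) where
  open StrictTotalOrder O using (Carrier; _<?_) renaming (_<_ to _<ₒ_)

  G> : ∀ {d} → (Fin d → Carrier) → (Fin d → Carrier) → ℕ
  G> x y = count (λ i → y i <? x i)

  _≻_ : ∀ {d} → (Fin d → Carrier) → (Fin d → Carrier) → Set
  x ≻ y = G> y x < G> x y

  Realizer : ∀ {n} (D : Digraph n) (d : ℕ) → (Fin n → Fin d → Carrier) → Set
  Realizer D d f = ∀ u v → (Arc D u v → f u ≻ f v) × (f u ≻ f v → Arc D u v)

  HasRealizer : ∀ {n} → Digraph n → ℕ → Set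
  HasRealizer {n} D d = Σ (Fin n → Fin d → Carrier) (Realizer D d)

  DimGreaterThan : ∀ {n} → Digraph n → ℕ → Set
  DimGreaterThan D d = ∀ d' → d' ≤ d → ¬ HasRealizer D d'

{-# OPTIONS --safe #-}
-- Bipartite digraphs on k + k vertices, all of whose arcs go from the left half to the
-- right half, are transitive because they contain no directed path of length two, and there
-- are 2^(k²) of them. Replacing every coordinate of a realizer by the rank of the vertex in
-- that coordinate, and padding with constant coordinates, turns any realizer of an n-vertex
-- digraph in dimension at most d into a map Fin n → Fin d → Fin n realizing it; there are only
-- n^(dn) such maps, and each realizes a single digraph. As (2k)^(2dk) < 2^(k²) for
-- k = 2^(8d+4), some bipartite digraph has no realizer in dimension at most d.
module Submission where

open import Defs
open import Level using (0ℓ)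
open import Data.Nat as ℕ using (ℕ; zero; suc; _≤_; _+_; _*_; _^_; z≤n; s≤s; z<s; s<s)
import Data.Nat.Properties as ℕ
open import Data.Nat.Properties
  using (≤-antisym; ≤⇒≯; m≤n⇒m≤1+n; m≤n⇒∃[o]m+o≡n; +-identityʳ; m^n>0; m^n≢0; ^-*-assoc; ^-distribˡ-+-*)
open import Data.Nat.Tactic.RingSolver using (solve-∀)
open import Data.Fin as Fin using (Fin; zero; suc; _↑ˡ_; _↑ʳ_; splitAt; toℕ; fromℕ<; funToFin; finToFun)
import Data.Fin.Properties as Fin
open import Data.Vec.Functional using (_++_)
open import Data.Vec.Functional.Properties using (lookup-++ˡ; lookup-++ʳ)
open import Data.Product using (Σ; _×_; _,_; proj₁; proj₂; ∃)
open import Data.Sum using (_⊎_; inj₁; inj₂)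
open import Data.Unit using (tt)
open import Data.Empty using (⊥)
open import Function using (_∘_; id; const; _⇔_; mk⇔; Equivalence)
open import Relation.Nullary using (¬_; Dec; yes; no; contradiction)
open import Relation.Binary.Bundles using (StrictTotalOrder)
open import Relation.Binary.Definitions using (tri<; tri≈; tri>)
open import Relation.Binary.PropositionalEquality

open Equivalence using (to; from)

count-mono : ∀ {d} {P Q : Fin d → Set} (p? : ∀ i → Dec (P i)) (q? : ∀ i → Dec (Q i)) →
             (∀ i → P i → Q i) → count p? ≤ count q?
count-mono {zero}  p? q? P⇒Q = z≤n
count-mono {suc d} p? q? P⇒Q with p? zero | q? zero
... | yes _ | yes _ = s≤s (count-mono (p? ∘ suc) (q? ∘ suc) (P⇒Q ∘ suc))
... | yes p | no ¬q = contradiction (P⇒Q zero p) ¬q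
... | no _  | yes _ = m≤n⇒m≤1+n (count-mono (p? ∘ suc) (q? ∘ suc) (P⇒Q ∘ suc))
... | no _  | no _  = count-mono (p? ∘ suc) (q? ∘ suc) (P⇒Q ∘ suc)

count-mono-< : ∀ {d} {P Q : Fin d → Set} (p? : ∀ i → Dec (P i)) (q? : ∀ i → Dec (Q i)) →
               (∀ i → P i → Q i) → ∀ w → ¬ P w → Q w → count p? ℕ.< count q?
count-mono-< {suc d} p? q? P⇒Q w ¬pw qw with p? zero | q? zero | w
... | yes p | _     | zero   = contradiction p ¬pw
... | yes p | no ¬q | _      = contradiction (P⇒Q zero p) ¬q
... | yes _ | yes _ | suc w  = s≤s (count-mono-< (p? ∘ suc) (q? ∘ suc) (P⇒Q ∘ suc) w ¬pw qw)
... | no _  | yes _ | _      = s≤s (count-mono (p? ∘ suc) (q? ∘ suc) (P⇒Q ∘ suc))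
... | no _  | no ¬q | zero   = contradiction qw ¬q
... | no _  | no _  | suc w  = count-mono-< (p? ∘ suc) (q? ∘ suc) (P⇒Q ∘ suc) w ¬pw qw

count-cong : ∀ {d} {P Q : Fin d → Set} (p? : ∀ i → Dec (P i)) (q? : ∀ i → Dec (Q i)) →
             (∀ i → P i ⇔ Q i) → count p? ≡ count q?
count-cong p? q? P⇔Q = ≤-antisym (count-mono p? q? (to ∘ P⇔Q)) (count-mono q? p? (from ∘ P⇔Q))

count-none : ∀ {d} {P : Fin d → Set} (p? : ∀ i → Dec (P i)) → (∀ i → ¬ P i) → count p? ≡ 0
count-none {zero}  p? ¬P = refl
count-none {suc d} p? ¬P with p? zero
... | yes p = contradiction p (¬P zero)
... | no _  = count-none (p? ∘ suc) (¬P ∘ suc)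

count-all : ∀ {d} {P : Fin d → Set} (p? : ∀ i → Dec (P i)) → (∀ i → P i) → count p? ≡ d
count-all {zero}  p? allP = refl
count-all {suc d} p? allP with p? zero
... | yes _ = cong suc (count-all (p? ∘ suc) (allP ∘ suc))
... | no ¬p = contradiction (allP zero) ¬p

count< : ∀ {d} {P : Fin d → Set} (p? : ∀ i → Dec (P i)) → ∀ w → ¬ P w → count p? ℕ.< d
count< p? w ¬pw = subst (count p? ℕ.<_) (count-all (λ _ → yes tt) (λ _ → tt))
  (count-mono-< p? (λ _ → yes tt) (λ _ _ → tt) w ¬pw tt)

count-↑ : ∀ m n {P : Fin (m + n) → Set} (p? : ∀ i → Dec (P i)) →
          count p? ≡ count (λ i → p? (i ↑ˡ n)) + count (λ j → p? (m ↑ʳ j))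
count-↑ zero    n p? = refl
count-↑ (suc m) n p? with p? zero
... | yes _ = cong suc (count-↑ m n (p? ∘ suc))
... | no _  = count-↑ m n (p? ∘ suc)

module FinMajority (n : ℕ) = Majority (Fin.<-strictTotalOrder n)

module _ (O O′ : StrictTotalOrder 0ℓ 0ℓ 0ℓ) where
  private
    module O  = StrictTotalOrder O
    module O′ = StrictTotalOrder O′
    module M  = Majority O
    module M′ = Majority O′

  G>-transfer : ∀ {d} {x y : Fin d → O.Carrier} {x′ y′ : Fin d → O′.Carrier} →
                (∀ i → y i O.< x i ⇔ y′ i O′.< x′ i) → M.G> x y ≡ M′.G> x′ y′
  G>-transfer = count-cong _ _

  realizer-transfer : ∀ {n d d′} {D : Digraph n}
                      (f : Fin n → Fin d → O.Carrier) (f′ : Fin n → Fin d′ → O′.Carrier) →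
                      (∀ u v → M.G> (f u) (f v) ≡ M′.G> (f′ u) (f′ v)) →
                      M.Realizer D d f → M′.Realizer D d′ f′
  realizer-transfer f f′ G>≡ R u v =
    (λ arc → subst₂ ℕ._<_ (G>≡ v u) (G>≡ u v) (proj₁ (R u v) arc)) ,
    (λ u≻v → proj₂ (R u v) (subst₂ ℕ._<_ (sym (G>≡ v u)) (sym (G>≡ u v)) u≻v))

module MajorityProperties (O : StrictTotalOrder 0ℓ 0ℓ 0ℓ) where
  open StrictTotalOrder O using (Carrier; _<_; _<?_; irrefl; module Eq)
  open Majority O

  _≻?_ : ∀ {d} (x y : Fin d → Carrier) → Dec (x ≻ y)
  x ≻? y = G> y x ℕ.<? G> x y

  G>-cong : ∀ {d} {x y x′ y′ : Fin d → Carrier} → x ≗ x′ → y ≗ y′ → G> x y ≡ G> x′ y′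
  G>-cong x≗x′ y≗y′ = G>-transfer O O (λ i → mk⇔ (subst₂ _<_ (y≗y′ i) (x≗x′ i))
                                                (subst₂ _<_ (sym (y≗y′ i)) (sym (x≗x′ i))))

  G>-self : ∀ {d} (x : Fin d → Carrier) → G> x x ≡ 0
  G>-self x = count-none (λ i → x i <? x i) (λ i → irrefl Eq.refl)

  G>-++ : ∀ {m n} (x y : Fin m → Carrier) (x′ y′ : Fin n → Carrier) →
          G> (x ++ x′) (y ++ y′) ≡ G> x y + G> x′ y′
  G>-++ {m} {n} x y x′ y′ = trans (count-↑ m n (λ i → (y ++ y′) i <? (x ++ x′) i))
    (cong₂ _+_ (G>-cong (lookup-++ˡ x x′) (lookup-++ˡ y y′))
               (G>-cong (lookup-++ʳ x x′) (lookup-++ʳ y y′)))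

  realizer-cong : ∀ {n d} {D : Digraph n} {f f′ : Fin n → Fin d → Carrier} →
                  (∀ u → f u ≗ f′ u) → Realizer D d f → Realizer D d f′
  realizer-cong {D = D} {f} {f′} f≗f′ =
    realizer-transfer O O {D = D} f f′ λ u v → G>-cong (f≗f′ u) (f≗f′ v)

  pad-realizer : ∀ {n d e} {D : Digraph n} {f : Fin n → Fin d → Carrier} (c : Carrier) →
                 Realizer D d f → Realizer D (d + e) (λ u → f u ++ const c)
  pad-realizer {e = e} {D} {f} c = realizer-transfer O O {D = D} f (λ u → f u ++ cs) λ u v → begin
    G> (f u) (f v)                    ≡⟨ +-identityʳ _ ⟨
    G> (f u) (f v) + 0                ≡⟨ cong (G> (f u) (f v) +_) (G>-self cs) ⟨
    G> (f u) (f v) + G> cs cs         ≡⟨ G>-++ (f u) (f v) cs cs ⟨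
    G> (f u ++ cs) (f v ++ cs)        ∎
    where
    open ≡-Reasoning
    cs : Fin e → Carrier
    cs = const c

module Ranking (O : StrictTotalOrder 0ℓ 0ℓ 0ℓ) where
  open StrictTotalOrder O using (Carrier; _<_; _<?_; compare; irrefl; <-respʳ-≈; module Eq)
    renaming (trans to <-trans)

  rankℕ : ∀ {n} → (Fin n → Carrier) → Fin n → ℕ
  rankℕ g u = count (λ w → g w <? g u)

  rank : ∀ {n} → (Fin n → Carrier) → Fin n → Fin n
  rank g u = fromℕ< (count< (λ w → g w <? g u) u (irrefl Eq.refl))

  toℕ-rank : ∀ {n} (g : Fin n → Carrier) u → toℕ (rank g u) ≡ rankℕ g u
  toℕ-rank g u = Fin.toℕ-fromℕ< _

  rankℕ-mono-< : ∀ {n} (g : Fin n → Carrier) {u v} → g u < g v → rankℕ g u ℕ.< rankℕ g v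
  rankℕ-mono-< g {u} {v} gu<gv =
    count-mono-< (λ w → g w <? g u) (λ w → g w <? g v) (λ w gw<gu → <-trans gw<gu gu<gv)
                 u (irrefl Eq.refl) gu<gv

  rankℕ-mono : ∀ {n} (g : Fin n → Carrier) {u v} → ¬ g u < g v → rankℕ g v ≤ rankℕ g u
  rankℕ-mono g {u} {v} gu≮gv = count-mono (λ w → g w <? g v) (λ w → g w <? g u) gw<gu
    where
    gw<gu : ∀ w → g w < g v → g w < g u
    gw<gu w gw<gv with compare (g u) (g v)
    ... | tri< gu<gv _ _ = contradiction gu<gv gu≮gv
    ... | tri≈ _ gu≈gv _ = <-respʳ-≈ (Eq.sym gu≈gv) gw<gv
    ... | tri> _ _ gv<gu = <-trans gw<gv gv<gu

  rankℕ-cancel-< : ∀ {n} (g : Fin n → Carrier) {u v} → rankℕ g u ℕ.< rankℕ g v → g u < g v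
  rankℕ-cancel-< g {u} {v} ru<rv with g u <? g v
  ... | yes gu<gv = gu<gv
  ... | no gu≮gv  = contradiction ru<rv (≤⇒≯ (rankℕ-mono g gu≮gv))

  rank-<⇔ : ∀ {n} (g : Fin n → Carrier) {u v} → g u < g v ⇔ rank g u Fin.< rank g v
  rank-<⇔ g {u} {v} = mk⇔
    (λ gu<gv → subst₂ ℕ._<_ (sym (toℕ-rank g u)) (sym (toℕ-rank g v)) (rankℕ-mono-< g gu<gv))
    (λ ru<rv → rankℕ-cancel-< g (subst₂ ℕ._<_ (toℕ-rank g u) (toℕ-rank g v) ru<rv))

  rankwise : ∀ {n d} → (Fin n → Fin d → Carrier) → Fin n → Fin d → Fin n
  rankwise f u i = rank (λ w → f w i) u

  rank-realizer : ∀ {n d} {D : Digraph n} {f : Fin n → Fin d → Carrier} →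
                  Majority.Realizer O D d f → FinMajority.Realizer n D d (rankwise f)
  rank-realizer {n} {D = D} {f} = realizer-transfer O (Fin.<-strictTotalOrder n) {D = D} f (rankwise f)
    λ u v → G>-transfer O (Fin.<-strictTotalOrder n) λ i → rank-<⇔ (λ w → f w i)

Fin-realizer : ∀ {n d d′} {D : Digraph n} (O : StrictTotalOrder 0ℓ 0ℓ 0ℓ) → Fin n → d′ ≤ d →
               Majority.HasRealizer O D d′ → FinMajority.HasRealizer n D d
Fin-realizer {n} {D = D} O c d′≤d (f , R) with m≤n⇒∃[o]m+o≡n d′≤d
... | e , refl = _ , pad-realizer {D = D} {rankwise f} c (rank-realizer {D = D} {f} R)
  where
  open Ranking O using (rankwise; rank-realizer)
  open MajorityProperties (Fin.<-strictTotalOrder n) using (pad-realizer)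

funToFin-cong : ∀ {m n} {f g : Fin m → Fin n} → f ≗ g → funToFin f ≡ funToFin g
funToFin-cong {zero}  f≗g = refl
funToFin-cong {suc m} f≗g = cong₂ Fin.combine (f≗g zero) (funToFin-cong (f≗g ∘ suc))

funToFin₂ : ∀ {a b c} → (Fin a → Fin b → Fin c) → Fin ((c ^ b) ^ a)
funToFin₂ f = funToFin (funToFin ∘ f)

finToFun₂ : ∀ {a b c} → Fin ((c ^ b) ^ a) → Fin a → Fin b → Fin c
finToFun₂ {a} {b} {c} y u = finToFun (finToFun {c ^ b} {a} y u)

funToFin₂-cong : ∀ {a b c} {f g : Fin a → Fin b → Fin c} →
                 (∀ u → f u ≗ g u) → funToFin₂ f ≡ funToFin₂ g
funToFin₂-cong f≗g = funToFin-cong (λ u → funToFin-cong (f≗g u))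

finToFun₂-funToFin₂ : ∀ {a b c} (f : Fin a → Fin b → Fin c) u → finToFun₂ (funToFin₂ f) u ≗ f u
finToFun₂-funToFin₂ f u i = trans (cong (λ x → finToFun x i) (Fin.finToFun-funToFin (funToFin ∘ f) u))
                                  (Fin.finToFun-funToFin (f u) i)

funToFin₂-finToFun₂ : ∀ {a b c} (y : Fin ((c ^ b) ^ a)) → funToFin₂ {a} {b} {c} (finToFun₂ y) ≡ y
funToFin₂-finToFun₂ {a} {b} {c} y =
  trans (funToFin-cong (λ u → Fin.funToFin-finToFin {b} {c} (finToFun {c ^ b} {a} y u)))
        (Fin.funToFin-finToFin {a} {c ^ b} y)

<⇒∃-non-image : ∀ {m n} → m ℕ.< n → (g : Fin m → Fin n) → ∃ λ y → ∀ x → g x ≢ y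
<⇒∃-non-image {m} {n} m<n g with Fin.all? (λ y → Fin.any? (λ x → g x Fin.≟ y))
... | no ¬surjective = let y , y∉img = Fin.¬∀⟶∃¬ n _ (λ y → Fin.any? (λ x → g x Fin.≟ y)) ¬surjective
                       in y , λ x gx≡y → y∉img (x , gx≡y)
... | yes surjective with Fin.pigeonhole m<n (proj₁ ∘ surjective)
... | i , j , i<j , same-preimage = contradiction i≡j (Fin.<⇒≢ i<j)
  where
  i≡j : i ≡ j
  i≡j = trans (sym (proj₂ (surjective i))) (trans (cong g same-preimage) (proj₂ (surjective j)))

module Bipartite {k : ℕ} (M : Fin k → Fin k → Fin 2) where

  LeftToRight : Fin k ⊎ Fin k → Fin k ⊎ Fin k → Set
  LeftToRight (inj₁ a) (inj₂ b) = M a b ≡ suc zero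
  LeftToRight (inj₁ _) (inj₁ _) = ⊥
  LeftToRight (inj₂ _) _        = ⊥

  bipartite : Digraph (k + k)
  bipartite = record
    { Arc      = λ x y → LeftToRight (splitAt k x) (splitAt k y)
    ; loopless = λ x → irreflexive (splitAt k x)
    ; oneArc   = λ x y → asymmetric (splitAt k x) (splitAt k y)
    }
    where
    irreflexive : ∀ s → ¬ LeftToRight s s
    irreflexive (inj₁ _) ()
    irreflexive (inj₂ _) ()
    asymmetric : ∀ s t → LeftToRight s t → ¬ LeftToRight t s
    asymmetric (inj₁ _) (inj₂ _) _ ()

  bipartite-transitive : Transitive bipartite
  bipartite-transitive x y z = noPath₂ (splitAt k x) (splitAt k y) (splitAt k z)
    where
    noPath₂ : ∀ s t u → LeftToRight s t → LeftToRight t u → LeftToRight s u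
    noPath₂ (inj₁ _) (inj₂ _) _ _ ()

  arc⇔ : ∀ a b → Arc bipartite (a ↑ˡ k) (k ↑ʳ b) ⇔ M a b ≡ suc zero
  arc⇔ a b rewrite Fin.splitAt-↑ˡ k a k | Fin.splitAt-↑ʳ k k b = mk⇔ id id

indicator : ∀ {P : Set} → Dec P → Fin 2
indicator (yes _) = suc zero
indicator (no _)  = zero

indicator-unique : ∀ {P : Set} (P? : Dec P) {x : Fin 2} → P ⇔ x ≡ suc zero → indicator P? ≡ x
indicator-unique (yes p)              P⇔x = sym (to P⇔x p)
indicator-unique (no ¬p) {zero}       P⇔x = refl
indicator-unique (no ¬p) {suc zero}   P⇔x = contradiction (from P⇔x refl) ¬p

module _ {k d : ℕ} where
  open FinMajority (k + k)
  open MajorityProperties (Fin.<-strictTotalOrder (k + k)) using (_≻?_; realizer-cong)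
  open Bipartite

  arcMatrix : (Fin (k + k) → Fin d → Fin (k + k)) → Fin k → Fin k → Fin 2
  arcMatrix r a b = indicator (r (a ↑ˡ k) ≻? r (k ↑ʳ b))

  arcMatrix-realizer : ∀ M r → Realizer (bipartite M) d r → ∀ a b → arcMatrix r a b ≡ M a b
  arcMatrix-realizer M r R a b = indicator-unique (r (a ↑ˡ k) ≻? r (k ↑ʳ b))
    (mk⇔ (to (arc⇔ M a b) ∘ proj₂ (R _ _)) (proj₁ (R _ _) ∘ from (arc⇔ M a b)))

  some-bipartite-unrealizable : ((k + k) ^ d) ^ (k + k) ℕ.< (2 ^ k) ^ k →
                                ∃ λ M → ¬ HasRealizer (bipartite M) d
  some-bipartite-unrealizable codes< with <⇒∃-non-image codes< (funToFin₂ ∘ arcMatrix ∘ finToFun₂)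
  ... | y , y∉image = M , unrealizable
    where
    M : Fin k → Fin k → Fin 2
    M = finToFun₂ y

    unrealizable : ¬ HasRealizer (bipartite M) d
    unrealizable (r , R) = y∉image (funToFin₂ r) (begin
      funToFin₂ (arcMatrix (finToFun₂ (funToFin₂ r)))  ≡⟨ funToFin₂-cong (arcMatrix-realizer M _ R′) ⟩
      funToFin₂ M                                       ≡⟨ funToFin₂-finToFun₂ {k} {k} {2} y ⟩
      y                                                 ∎)
      where
      open ≡-Reasoning
      R′ : Realizer (bipartite M) d (finToFun₂ (funToFin₂ r))
      R′ = realizer-cong {D = bipartite M} (λ u → sym ∘ finToFun₂-funToFin₂ r u) R

n<2^n : ∀ n → n ℕ.< 2 ^ n
n<2^n zero    = z<s
n<2^n (suc n) = ℕ.+-mono-≤ (m^n>0 2 n) (ℕ.≤-trans (n<2^n n) (ℕ.m≤m+n (2 ^ n) 0))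

m*[1+j]<2^j : ∀ m → let j = 4 * m + 4 in m * suc j ℕ.< 2 ^ j
m*[1+j]<2^j m = begin-strict
  m * suc (4 * m + 4)                    <⟨ ℕ.m<m+n _ z<s ⟩
  m * suc (4 * m + 4) + suc (3 * m + 3)  ≡⟨ square m ⟩
  t * t                                  <⟨ ℕ.*-mono-< (n<2^n t) (n<2^n t) ⟩
  2 ^ t * 2 ^ t                          ≡⟨ ^-distribˡ-+-* 2 t t ⟨
  2 ^ (t + t)                            ≡⟨ cong (2 ^_) (double m) ⟩
  2 ^ (4 * m + 4)                        ∎
  where
  open ℕ.≤-Reasoning
  t = 2 * m + 2
  square : ∀ m → m * suc (4 * m + 4) + suc (3 * m + 3) ≡ (2 * m + 2) * (2 * m + 2)
  square = solve-∀
  double : ∀ m → (2 * m + 2) + (2 * m + 2) ≡ 4 * m + 4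
  double = solve-∀

realizer-codes<bipartite-digraphs : ∀ d → ∃ λ k → ((k + k) ^ d) ^ (k + k) ℕ.< (2 ^ k) ^ k
realizer-codes<bipartite-digraphs d = k , (begin-strict
  ((k + k) ^ d) ^ (k + k)      ≡⟨ cong (λ n → (n ^ d) ^ (k + k)) k+k≡2^[1+j] ⟩
  ((2 ^ suc j) ^ d) ^ (k + k)  ≡⟨ cong (_^ (k + k)) (^-*-assoc 2 (suc j) d) ⟩
  (2 ^ (suc j * d)) ^ (k + k)  ≡⟨ ^-*-assoc 2 (suc j * d) (k + k) ⟩
  2 ^ (suc j * d * (k + k))    <⟨ ℕ.^-monoʳ-< 2 (s<s z<s) exponent< ⟩
  2 ^ (k * k)                  ≡⟨ ^-*-assoc 2 k k ⟨
  (2 ^ k) ^ k                  ∎)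
  where
  open ℕ.≤-Reasoning
  j = 4 * (2 * d) + 4
  k = 2 ^ j
  instance _ = m^n≢0 2 j
  k+k≡2^[1+j] : k + k ≡ 2 ^ suc j
  k+k≡2^[1+j] = cong (k +_) (sym (+-identityʳ k))
  regroup : ∀ a b c → a * b * (c + c) ≡ 2 * b * a * c
  regroup = solve-∀
  exponent< : suc j * d * (k + k) ℕ.< k * k
  exponent< = begin-strict
    suc j * d * (k + k)  ≡⟨ regroup (suc j) d k ⟩
    2 * d * suc j * k    <⟨ ℕ.*-monoˡ-< k (m*[1+j]<2^j (2 * d)) ⟩
    k * k                ∎

theorem2p7 : (d : ℕ) → 1 ≤ d → Σ ℕ (λ n → Σ (Digraph n) (λ D → Transitive D × ((O : StrictTotalOrder 0ℓ 0ℓ 0ℓ) → Majority.DimGreaterThan O D d)))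
theorem2p7 d _ with realizer-codes<bipartite-digraphs d
... | zero , s<s ()
... | k@(suc _) , codes< =
  let M , unrealizable = some-bipartite-unrealizable {k} {d} codes<
  in  k + k , bipartite M , bipartite-transitive M ,
      λ O d′ d′≤d realizable → unrealizable (Fin-realizer {D = bipartite M} O zero d′≤d realizable)
  where open Bipartite
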